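{- Let $R$ be a consistent triple set and let $\{A,B\},\{A',B'\}$ be distinct elements of $\mathfrak L^*(R;R)$. If $A\cap A'\ne\emptyset$, then $B\cap B'=\emptyset$.
   Context: A rooted tree $T$ has a distinguished inner vertex (root); leaves are degree-1 vertices; inner vertices other than the root have degree at least 3. A triple $ab|c$ is the rooted binary tree on leaves $a,b,c$ where the path from $a$ to $b$ avoids the path from $c$ to the root; $ab|c=ba|c$. A rooted tree displays $ab|c$ if $a,b,c$ are leaves and the path from $a$ to $b$ does not intersect the path from $c$ to the root; $\mathcal R(T)$ is the set of displayed triples. A triple set is consistent if some rooted tree displays all its triples. $L_R$ is the set of leaves appearing in $R$. $\mathrm{cl}(R)=\bigcap\mathcal R(T)$ over all rooted trees $T$ with leaf set $L_R$ displaying $R$. For $\mathcal L\subseteq L_R$, the Ahograph $[R,\mathcal L]$ has vertex set $\mathcal L$, distinct $x,y\in\mathcal L$ adjacent iff some $xy|z\in R$ has $z\in\mathcal L$; connected components are identified with vertex sets. $\mathfrak L(ab|c;R)$ is the set of unordered pairs $\{A,B\}$, $A,B\subseteq L_R$, such that $[R,A\cup B]$ has exactly two connected components $A$ and $B$, one containing $a,b$ and the other $c$; for $ab|c\in\mathrm{cl}(R)$ it has a unique element maximizing $|A\cup B|$, denoted $\mathfrak L^*(ab|c;R)$. $\mathfrak L^*(R;R)=\{\mathfrak L^*(r;R): r\in R\}$. -}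

module Defs where

open import Data.Nat using (ℕ; _≤_)
open import Data.Fin using (Fin)
open import Data.Fin.Subset using (Subset; _∈_; _∉_; _⊆_; _∪_; ⁅_⁆; ∣_∣)
  renaming (⊥ to ∅)
open import Data.List using (List; []; _∷_; _++_; [_]; length; foldr)
import Data.List.Membership.Propositional as LM
open import Data.List.Relation.Unary.All using (All)
open import Data.List.Relation.Unary.Any using (Any)
open import Data.List.Relation.Unary.Unique.Propositional using (Unique)
open import Data.Product using (Σ; ∃; _×_; _,_)
open import Data.Sum using (_⊎_)
open import Data.Empty using (⊥)
open import Data.Unit using (⊤)
open import Relation.Nullary using (¬_)
open import Relation.Binary.PropositionalEquality using (_≡_; _≢_)
open import Relation.Binary.Construct.Closure.ReflexiveTransitive using (Star)

-- Leaves are labelled by Fin n (any finite leaf set can be so labelled).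

-- Triples.  A triple ab|c is represented by the ordered tuple (a , b , c);
-- ab|c = ba|c is handled by the symmetric membership _∈ᵗ_ below.

Triple : ℕ → Set
Triple n = Fin n × Fin n × Fin n

ValidTriple : ∀ {n} → Triple n → Set
ValidTriple (a , b , c) = a ≢ b × a ≢ c × b ≢ c

TripleSet : ℕ → Set
TripleSet n = List (Triple n)

_∈ᵗ_ : ∀ {n} → Triple n → TripleSet n → Set
(x , y , z) ∈ᵗ R = ((x , y , z) LM.∈ R) ⊎ ((y , x , z) LM.∈ R)

leafSet : ∀ {n} → TripleSet n → Subset n
leafSet = foldr (λ { (a , b , c) S → ⁅ a ⁆ ∪ (⁅ b ⁆ ∪ (⁅ c ⁆ ∪ S)) }) ∅

data Tree (n : ℕ) : Set where
  leaf : Fin n → Tree n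
  node : List (Tree n) → Tree n

mutual
  leaves : ∀ {n} → Tree n → List (Fin n)
  leaves (leaf x)  = [ x ]
  leaves (node ts) = leavesL ts

  leavesL : ∀ {n} → List (Tree n) → List (Fin n)
  leavesL []       = []
  leavesL (t ∷ ts) = leaves t ++ leavesL ts

-- Non-root inner vertices have degree ≥ 3, i.e. at least 2 children.
mutual
  WFNonRoot : ∀ {n} → Tree n → Set
  WFNonRoot (leaf x)  = ⊤
  WFNonRoot (node ts) = 2 ≤ length ts × WFNonRootL ts

  WFNonRootL : ∀ {n} → List (Tree n) → Set
  WFNonRootL []       = ⊤
  WFNonRootL (t ∷ ts) = WFNonRoot t × WFNonRootL ts

-- A rooted tree: the root is an inner vertex (not of degree 1, i.e. it does
-- not have exactly one child), all other inner vertices have ≥ 2 children,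
-- and distinct leaves carry distinct labels.
IsRootedTree : ∀ {n} → Tree n → Set
IsRootedTree (leaf x)      = ⊥
IsRootedTree t@(node ts)   = (length ts ≢ 1) × WFNonRootL ts × Unique (leaves t)

data _⊑_ {n} (S : Tree n) : Tree n → Set where
  here  : S ⊑ S
  there : ∀ {ts} → Any (S ⊑_) ts → S ⊑ node ts

-- T displays ab|c: a, b, c are leaves of T and the path from a to b avoids
-- the path from c to the root, i.e. some vertex v (the lca of a and b) has
-- a and b below it but not c.
Displays : ∀ {n} → Tree n → Triple n → Set
Displays T (a , b , c) =
  a LM.∈ leaves T × b LM.∈ leaves T × c LM.∈ leaves T ×
  ∃ λ S → S ⊑ T × a LM.∈ leaves S × b LM.∈ leaves S × ¬ (c LM.∈ leaves S)

Consistent : ∀ {n} → TripleSet n → Set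
Consistent R = ∃ λ T → IsRootedTree T × All (Displays T) R

HasLeafSet : ∀ {n} → Tree n → Subset n → Set
HasLeafSet T L = ∀ x → (x LM.∈ leaves T → x ∈ L) × (x ∈ L → x LM.∈ leaves T)

_∈cl_ : ∀ {n} → Triple n → TripleSet n → Set
r ∈cl R = ∀ T → IsRootedTree T → HasLeafSet T (leafSet R) → All (Displays T) R
          → Displays T r

AhoAdj : ∀ {n} → TripleSet n → Subset n → Fin n → Fin n → Set
AhoAdj R V x y = x ∈ V × y ∈ V × x ≢ y × ∃ λ z → z ∈ V × (x , y , z) ∈ᵗ R

IsComponent : ∀ {n} → TripleSet n → Subset n → Subset n → Set
IsComponent R V C = ∃ λ x → x ∈ V ×
  (∀ y → (y ∈ C → Star (AhoAdj R V) x y) × (Star (AhoAdj R V) x y → y ∈ C))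

ExactlyTwoComponents : ∀ {n} → TripleSet n → Subset n → Subset n → Subset n → Set
ExactlyTwoComponents R V A B =
  IsComponent R V A × IsComponent R V B × A ≢ B ×
  (∀ C → IsComponent R V C → (C ≡ A) ⊎ (C ≡ B))

InLSet : ∀ {n} → Triple n → TripleSet n → Subset n → Subset n → Set
InLSet (a , b , c) R A B =
  A ⊆ leafSet R × B ⊆ leafSet R × ExactlyTwoComponents R (A ∪ B) A B ×
  ((a ∈ A × b ∈ A × c ∈ B) ⊎ (a ∈ B × b ∈ B × c ∈ A))

-- {A , B} = 𝔏*(r ; R): the element of 𝔏(r;R) maximizing |A ∪ B|
-- (unique for r ∈ cl(R), as stated in the paper).
IsLStar : ∀ {n} → Triple n → TripleSet n → Subset n → Subset n → Set
IsLStar r R A B = InLSet r R A B ×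
  (∀ A' B' → InLSet r R A' B' → ∣ A' ∪ B' ∣ ≤ ∣ A ∪ B ∣)

InLStarR : ∀ {n} → TripleSet n → Subset n → Subset n → Set
InLStarR R A B = ∃ λ r → r LM.∈ R × IsLStar r R A B

SamePair : ∀ {n} → Subset n → Subset n → Subset n → Subset n → Set
SamePair A B A' B' = (A ≡ A' × B ≡ B') ⊎ (A ≡ B' × B ≡ A')

module Submission where

-- Suppose {A,B} = 𝔏*(r;R), {A',B'} = 𝔏*(r';R), p ∈ A ∩ A' and q ∈ B ∩ B'.
-- Put P = A ∪ A', Q = B ∪ B' and U = P ∪ Q.  In the Ahograph [R,U] every
-- vertex of P is joined to p and every vertex of Q to q.  By Aho's lemma the
-- Ahograph of a consistent triple set on two distinct leaves is disconnected,
-- so p is not joined to q; hence P and Q are exactly the two components of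
-- [R,U] and {P,Q} ∈ 𝔏(r;R).  Maximality of 𝔏*(r;R) gives A' ∪ B' ⊆ A ∪ B, and
-- symmetrically A ∪ B ⊆ A' ∪ B'.  Components of one graph sharing a vertex
-- coincide, so A = A' and B = B', i.e. the two pairs are equal.

open import Defs
open import Data.Nat using (ℕ; _≤_)
open import Data.Nat.Properties using (<⇒≱)
open import Data.Fin using (Fin)
open import Data.Fin.Subset using (Subset; _∈_; _⊆_; _∪_; _∩_; ⁅_⁆; ∣_∣; Nonempty; Empty)
open import Data.Fin.Subset.Properties
  using (x∈p∪q⁻; p⊆p∪q; q⊆p∪q; x∈⁅y⁆⇒x≡y; x∈p∩q⁻; ∉⊥; ⊆-trans; ⊆-antisym; p⊂q⇒∣p∣<∣q∣; _∈?_)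
open import Data.List using (List; []; _∷_; _++_)
open import Data.List.Membership.Propositional using () renaming (_∈_ to _∈ₗ_)
open import Data.List.Membership.Propositional.Properties using (∈-++⁻; ∈-++⁺ˡ; ∈-++⁺ʳ)
open import Data.List.Relation.Unary.All as All using (All; _∷_)
open import Data.List.Relation.Unary.All.Properties using (++⁻ˡ)
open import Data.List.Relation.Unary.Any as Any using (Any; here; there)
open import Data.List.Relation.Unary.AllPairs using ([]; _∷_)
open import Data.List.Relation.Unary.Unique.Propositional using (Unique)
open import Data.Product using (∃; _×_; _,_; proj₁; proj₂)
open import Data.Sum using (_⊎_; inj₁; inj₂; [_,_])
open import Data.Empty using (⊥; ⊥-elim)
open import Relation.Nullary using (¬_; yes; no)
open import Relation.Binary.PropositionalEquality using (_≡_; _≢_; refl; sym; trans; subst)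
open import Relation.Binary.Construct.Closure.ReflexiveTransitive
  using (Star; ε; _◅_; _◅◅_; gmap; reverse)

module _ {n : ℕ} where

  ∪-lub : {X Y Z : Subset n} → X ⊆ Z → Y ⊆ Z → X ∪ Y ⊆ Z
  ∪-lub {X} {Y} X⊆Z Y⊆Z x∈ = [ X⊆Z , Y⊆Z ] (x∈p∪q⁻ X Y x∈)

  ∪-mono : {X X' Y Y' : Subset n} → X ⊆ X' → Y ⊆ Y' → X ∪ Y ⊆ X' ∪ Y'
  ∪-mono {X' = X'} {Y' = Y'} X⊆X' Y⊆Y' =
    ∪-lub (λ x∈X → p⊆p∪q Y' (X⊆X' x∈X)) (λ y∈Y → q⊆p∪q X' Y' (Y⊆Y' y∈Y))

  ⊇-by-card : {X Y : Subset n} → X ⊆ Y → ∣ Y ∣ ≤ ∣ X ∣ → Y ⊆ X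
  ⊇-by-card {X} X⊆Y ∣Y∣≤∣X∣ {y} y∈Y with y ∈? X
  ... | yes y∈X = y∈X
  ... | no y∉X  = ⊥-elim (<⇒≱ (p⊂q⇒∣p∣<∣q∣ (X⊆Y , y , y∈Y , y∉X)) ∣Y∣≤∣X∣)

module _ {A : Set} where

  unique-++-disjoint : ∀ (xs : List A) {ys v} → Unique (xs ++ ys) → v ∈ₗ xs → v ∈ₗ ys → ⊥
  unique-++-disjoint (x ∷ xs) (x∉ ∷ _) (here refl) v∈ys = All.lookup x∉ (∈-++⁺ʳ xs v∈ys) refl
  unique-++-disjoint (x ∷ xs) (_ ∷ u) (there v∈xs) v∈ys = unique-++-disjoint xs u v∈xs v∈ys

  unique-++ˡ : ∀ (xs : List A) {ys} → Unique (xs ++ ys) → Unique xs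
  unique-++ˡ []       _        = []
  unique-++ˡ (x ∷ xs) (x∉ ∷ u) = ++⁻ˡ xs x∉ ∷ unique-++ˡ xs u

  unique-++ʳ : ∀ (xs : List A) {ys} → Unique (xs ++ ys) → Unique ys
  unique-++ʳ []       u       = u
  unique-++ʳ (x ∷ xs) (_ ∷ u) = unique-++ʳ xs u

module _ {n : ℕ} where

  child⊑ : ∀ {t : Tree n} {ts} → t ∈ₗ ts → t ⊑ node ts
  child⊑ t∈ts = there (Any.map (λ { refl → here }) t∈ts)

  mutual
    ⊑-leaves : ∀ {S T : Tree n} {x} → S ⊑ T → x ∈ₗ leaves S → x ∈ₗ leaves T
    ⊑-leaves here      x∈S = x∈S
    ⊑-leaves (there p) x∈S = ⊑-leavesL p x∈S

    ⊑-leavesL : ∀ {S : Tree n} {ts x} → Any (S ⊑_) ts → x ∈ₗ leaves S → x ∈ₗ leavesL ts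
    ⊑-leavesL {ts = t ∷ ts} (here p)  x∈S = ∈-++⁺ˡ (⊑-leaves p x∈S)
    ⊑-leavesL {ts = t ∷ ts} (there p) x∈S = ∈-++⁺ʳ (leaves t) (⊑-leavesL p x∈S)

  mutual
    ⊑-unique : ∀ {S T : Tree n} → S ⊑ T → Unique (leaves T) → Unique (leaves S)
    ⊑-unique here      u = u
    ⊑-unique (there p) u = ⊑-uniqueL p u

    ⊑-uniqueL : ∀ {S : Tree n} {ts} → Any (S ⊑_) ts → Unique (leavesL ts) → Unique (leaves S)
    ⊑-uniqueL {ts = t ∷ ts} (here p)  u = ⊑-unique p (unique-++ˡ (leaves t) u)
    ⊑-uniqueL {ts = t ∷ ts} (there p) u = ⊑-uniqueL p (unique-++ʳ (leaves t) u)

  mutual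
    ⊑-trans : ∀ {S S' T : Tree n} → S ⊑ S' → S' ⊑ T → S ⊑ T
    ⊑-trans p here      = p
    ⊑-trans p (there q) = there (⊑-transL p q)

    ⊑-transL : ∀ {S S' : Tree n} {ts} → S ⊑ S' → Any (S' ⊑_) ts → Any (S ⊑_) ts
    ⊑-transL p (here q)  = here (⊑-trans p q)
    ⊑-transL p (there q) = there (⊑-transL p q)

  mutual
    ⊑-comparable : ∀ {S₁ S₂ T : Tree n} {x} → Unique (leaves T) → S₁ ⊑ T → S₂ ⊑ T →
                   x ∈ₗ leaves S₁ → x ∈ₗ leaves S₂ → S₁ ⊑ S₂ ⊎ S₂ ⊑ S₁
    ⊑-comparable u here      q         _   _   = inj₂ q
    ⊑-comparable u (there p) here      _   _   = inj₁ (there p)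
    ⊑-comparable u (there p) (there q) x∈₁ x∈₂ = ⊑-comparableL u p q x∈₁ x∈₂

    ⊑-comparableL : ∀ {S₁ S₂ : Tree n} {ts x} → Unique (leavesL ts) → Any (S₁ ⊑_) ts →
                    Any (S₂ ⊑_) ts → x ∈ₗ leaves S₁ → x ∈ₗ leaves S₂ → S₁ ⊑ S₂ ⊎ S₂ ⊑ S₁
    ⊑-comparableL {ts = t ∷ ts} u (here p) (here q) x∈₁ x∈₂ =
      ⊑-comparable (unique-++ˡ (leaves t) u) p q x∈₁ x∈₂
    ⊑-comparableL {ts = t ∷ ts} u (here p) (there q) x∈₁ x∈₂ =
      ⊥-elim (unique-++-disjoint (leaves t) u (⊑-leaves p x∈₁) (⊑-leavesL q x∈₂))
    ⊑-comparableL {ts = t ∷ ts} u (there p) (here q) x∈₁ x∈₂ =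
      ⊥-elim (unique-++-disjoint (leaves t) u (⊑-leaves q x∈₂) (⊑-leavesL p x∈₁))
    ⊑-comparableL {ts = t ∷ ts} u (there p) (there q) x∈₁ x∈₂ =
      ⊑-comparableL (unique-++ʳ (leaves t) u) p q x∈₁ x∈₂

  ⊑-sameChild : ∀ {ts : List (Tree n)} {t S x} → Unique (leavesL ts) → t ∈ₗ ts →
                x ∈ₗ leaves t → Any (S ⊑_) ts → x ∈ₗ leaves S → S ⊑ t
  ⊑-sameChild {t₀ ∷ ts} u (here refl) x∈t (here p) x∈S = p
  ⊑-sameChild {t₀ ∷ ts} u (here refl) x∈t (there p) x∈S =
    ⊥-elim (unique-++-disjoint (leaves t₀) u x∈t (⊑-leavesL p x∈S))
  ⊑-sameChild {t₀ ∷ ts} u (there t∈ts) x∈t (here p) x∈S =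
    ⊥-elim (unique-++-disjoint (leaves t₀) u (⊑-leaves p x∈S) (⊑-leaves (child⊑ t∈ts) x∈t))
  ⊑-sameChild {t₀ ∷ ts} u (there t∈ts) x∈t (there p) x∈S =
    ⊑-sameChild (unique-++ʳ (leaves t₀) u) t∈ts x∈t p x∈S

∈⁅⁆-leaf : ∀ {n} {T : Tree n} {y z} → y ∈ ⁅ z ⁆ → z ∈ₗ leaves T → y ∈ₗ leaves T
∈⁅⁆-leaf {T = T} {z = z} y∈z = subst (_∈ₗ leaves T) (sym (x∈⁅y⁆⇒x≡y z y∈z))

leafSet⊆leaves : ∀ {n} (R : TripleSet n) {T : Tree n} → All (Displays T) R →
                 ∀ {y} → y ∈ leafSet R → y ∈ₗ leaves T
leafSet⊆leaves [] _ y∈∅ = ⊥-elim (∉⊥ y∈∅)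
leafSet⊆leaves ((a , b , c) ∷ R) {T} ((a∈T , b∈T , c∈T , _) ∷ displays) y∈
  with x∈p∪q⁻ ⁅ a ⁆ _ y∈
... | inj₁ y∈a = ∈⁅⁆-leaf {T = T} y∈a a∈T
... | inj₂ y∈ with x∈p∪q⁻ ⁅ b ⁆ _ y∈
...   | inj₁ y∈b = ∈⁅⁆-leaf {T = T} y∈b b∈T
...   | inj₂ y∈ with x∈p∪q⁻ ⁅ c ⁆ _ y∈
...     | inj₁ y∈c = ∈⁅⁆-leaf {T = T} y∈c c∈T
...     | inj₂ y∈R = leafSet⊆leaves R displays y∈R

Connected : ∀ {n} → TripleSet n → Subset n → Set
Connected R U = ∀ {x y} → x ∈ U → y ∈ U → Star (AhoAdj R U) x y

module AhoLemma {n} (R : TripleSet n) (T : Tree n) (uniqueT : Unique (leaves T))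
                (displays : All (Displays T) R) where

  separator : ∀ {x y z} → (x , y , z) ∈ᵗ R →
              ∃ λ S → S ⊑ T × x ∈ₗ leaves S × y ∈ₗ leaves S × ¬ (z ∈ₗ leaves S)
  separator (inj₁ xy|z) with All.lookup displays xy|z
  ... | _ , _ , _ , S , S⊑T , x∈S , y∈S , z∉S = S , S⊑T , x∈S , y∈S , z∉S
  separator (inj₂ yx|z) with All.lookup displays yx|z
  ... | _ , _ , _ , S , S⊑T , y∈S , x∈S , z∉S = S , S⊑T , x∈S , y∈S , z∉S

  module _ (U : Subset n) where

    Covers : Tree n → Set
    Covers S = ∀ {y} → y ∈ U → y ∈ₗ leaves S

    -- If node ts covers U, an edge of [R,U] never leaves a child t of node ts:
    -- the separating subtree of its triple lies strictly below node ts
    -- (it misses a vertex of U), hence inside the child containing x.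
    edge-stays : ∀ {ts t} → node ts ⊑ T → Covers (node ts) → t ∈ₗ ts →
                 ∀ {x y} → x ∈ₗ leaves t → AhoAdj R U x y → y ∈ₗ leaves t
    edge-stays ts⊑T cover t∈ts x∈t (_ , _ , _ , z , z∈U , xy|z) with separator xy|z
    ... | S , S⊑T , x∈S , y∈S , z∉S
        with ⊑-comparable uniqueT S⊑T ts⊑T x∈S (⊑-leaves (child⊑ t∈ts) x∈t)
    ...   | inj₂ ts⊑S        = ⊥-elim (z∉S (⊑-leaves ts⊑S (cover z∈U)))
    ...   | inj₁ here        = ⊥-elim (z∉S (cover z∈U))
    ...   | inj₁ (there S⊑c) =
            ⊑-leaves (⊑-sameChild (⊑-unique ts⊑T uniqueT) t∈ts x∈t S⊑c x∈S) y∈S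

    path-stays : ∀ {ts t} → node ts ⊑ T → Covers (node ts) → t ∈ₗ ts →
                 ∀ {x y} → x ∈ₗ leaves t → Star (AhoAdj R U) x y → y ∈ₗ leaves t
    path-stays ts⊑T cover t∈ts x∈t ε        = x∈t
    path-stays ts⊑T cover t∈ts x∈t (e ◅ es) =
      path-stays ts⊑T cover t∈ts (edge-stays ts⊑T cover t∈ts x∈t e) es

    -- If [R,U] is connected with two distinct vertices, no subtree covers U:
    -- a covering subtree is not a single leaf, and by path-stays the child
    -- containing u covers U as well; structural recursion on the subtree
    -- therefore ends in a contradiction.
    module _ {u v} (u∈U : u ∈ U) (v∈U : v ∈ U) (u≢v : u ≢ v)
             (connected : Connected R U) where
      mutual
        no-cover : (S : Tree n) → S ⊑ T → Covers S → ⊥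
        no-cover (leaf l) _ cover with cover u∈U | cover v∈U
        ... | here u≡l  | here v≡l  = u≢v (trans u≡l (sym v≡l))
        ... | there ()  | _
        ... | here _    | there ()
        no-cover (node ts) ts⊑T cover = no-cover-child ts ts ts⊑T cover (λ t∈ts → t∈ts) (cover u∈U)

        no-cover-child : ∀ ts ts′ → node ts ⊑ T → Covers (node ts) →
                         (∀ {t} → t ∈ₗ ts′ → t ∈ₗ ts) → u ∈ₗ leavesL ts′ → ⊥
        no-cover-child ts (t ∷ ts′) ts⊑T cover sub u∈ with ∈-++⁻ (leaves t) u∈
        ... | inj₁ u∈t  = no-cover t (⊑-trans (child⊑ t∈ts) ts⊑T)
                            (λ y∈U → path-stays ts⊑T cover t∈ts u∈t (connected u∈U y∈U))
          where
          t∈ts : t ∈ₗ ts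
          t∈ts = sub (here refl)
        ... | inj₂ u∈ts′ = no-cover-child ts ts′ ts⊑T cover (λ m → sub (there m)) u∈ts′

aho : ∀ {n} {R : TripleSet n} {U : Subset n} → Consistent R → U ⊆ leafSet R →
      ∀ {u v} → u ∈ U → v ∈ U → u ≢ v → ¬ Connected R U
aho (leaf _ , () , _)
aho {R = R} {U} (T@(node _) , (_ , _ , uniqueT) , displays) U⊆L u∈U v∈U u≢v connected =
  AhoLemma.no-cover R T uniqueT displays U u∈U v∈U u≢v connected T here
    (λ y∈U → leafSet⊆leaves R displays (U⊆L y∈U))

module Ahograph {n} (R : TripleSet n) where

  Path : Subset n → Fin n → Fin n → Set
  Path V = Star (AhoAdj R V)

  adj-sym : ∀ {V x y} → AhoAdj R V x y → AhoAdj R V y x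
  adj-sym (x∈ , y∈ , x≢y , z , z∈ , inj₁ m) = y∈ , x∈ , (λ e → x≢y (sym e)) , z , z∈ , inj₂ m
  adj-sym (x∈ , y∈ , x≢y , z , z∈ , inj₂ m) = y∈ , x∈ , (λ e → x≢y (sym e)) , z , z∈ , inj₁ m

  path-sym : ∀ {V x y} → Path V x y → Path V y x
  path-sym = reverse adj-sym

  path-mono : ∀ {V W} → V ⊆ W → ∀ {x y} → Path V x y → Path W x y
  path-mono V⊆W = gmap (λ x → x) λ { (x∈ , y∈ , x≢y , z , z∈ , m) →
                                       V⊆W x∈ , V⊆W y∈ , x≢y , z , V⊆W z∈ , m }

  path-end∈ : ∀ {V x y} → x ∈ V → Path V x y → y ∈ V
  path-end∈ x∈V ε                  = x∈V
  path-end∈ x∈V ((_ , y∈V , _) ◅ es) = path-end∈ y∈V es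

  component-path : ∀ {V C} → IsComponent R V C → ∀ {y y'} → y ∈ C → y' ∈ C → Path V y y'
  component-path (_ , _ , comp) y∈C y'∈C =
    path-sym (proj₁ (comp _) y∈C) ◅◅ proj₁ (comp _) y'∈C

  component-closed : ∀ {V C} → IsComponent R V C → ∀ {y y'} → y ∈ C → Path V y y' → y' ∈ C
  component-closed (_ , _ , comp) y∈C y⇝y' = proj₂ (comp _) (proj₁ (comp _) y∈C ◅◅ y⇝y')

  component-unique : ∀ {V W C D p} → IsComponent R V C → IsComponent R W D →
                     V ⊆ W → W ⊆ V → p ∈ C → p ∈ D → C ≡ D
  component-unique compC compD V⊆W W⊆V p∈C p∈D =
    ⊆-antisym (λ y∈C → component-closed compD p∈D (path-mono V⊆W (component-path compC p∈C y∈C)))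
              (λ y∈D → component-closed compC p∈C (path-mono W⊆V (component-path compD p∈D y∈D)))

  two-components : ∀ {P Q p q} → p ∈ P → q ∈ Q →
                   (∀ {y} → y ∈ P → Path (P ∪ Q) p y) → (∀ {y} → y ∈ Q → Path (P ∪ Q) q y) →
                   ¬ Path (P ∪ Q) p q → ExactlyTwoComponents R (P ∪ Q) P Q
  two-components {P} {Q} {p} {q} p∈P q∈Q reachP reachQ p↛q =
    componentP , componentQ , P≢Q , only
    where
    p∈U : p ∈ P ∪ Q
    p∈U = p⊆p∪q Q p∈P

    q∈U : q ∈ P ∪ Q
    q∈U = q⊆p∪q P Q q∈Q

    backP : ∀ {y} → Path (P ∪ Q) p y → y ∈ P
    backP p⇝y with x∈p∪q⁻ P Q (path-end∈ p∈U p⇝y)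
    ... | inj₁ y∈P = y∈P
    ... | inj₂ y∈Q = ⊥-elim (p↛q (p⇝y ◅◅ path-sym (reachQ y∈Q)))

    backQ : ∀ {y} → Path (P ∪ Q) q y → y ∈ Q
    backQ q⇝y with x∈p∪q⁻ P Q (path-end∈ q∈U q⇝y)
    ... | inj₁ y∈P = ⊥-elim (p↛q (reachP y∈P ◅◅ path-sym q⇝y))
    ... | inj₂ y∈Q = y∈Q

    componentP : IsComponent R (P ∪ Q) P
    componentP = p , p∈U , λ _ → reachP , backP

    componentQ : IsComponent R (P ∪ Q) Q
    componentQ = q , q∈U , λ _ → reachQ , backQ

    P≢Q : P ≢ Q
    P≢Q P≡Q = p↛q (path-sym (reachQ (subst (p ∈_) P≡Q p∈P)))

    only : ∀ C → IsComponent R (P ∪ Q) C → C ≡ P ⊎ C ≡ Q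
    only C compC@(x , x∈U , comp) with x∈p∪q⁻ P Q x∈U
    ... | inj₁ x∈P = inj₁ (component-unique compC componentP (λ y → y) (λ y → y) x∈C x∈P)
      where
      x∈C : x ∈ C
      x∈C = proj₂ (comp x) ε
    ... | inj₂ x∈Q = inj₂ (component-unique compC componentQ (λ y → y) (λ y → y) x∈C x∈Q)
      where
      x∈C : x ∈ C
      x∈C = proj₂ (comp x) ε

-- The merged sides are
-- internally connected, and they are not joined to each other since otherwise
-- [R, A ∪ A' ∪ B ∪ B'] would be connected, contradicting Aho's lemma.
merge : ∀ {n} {R : TripleSet n} {r r' : Triple n} {A B A' B' p q} →
        Consistent R → ValidTriple r → InLSet r R A B → InLSet r' R A' B' →
        p ∈ A → p ∈ A' → q ∈ B → q ∈ B' → InLSet r R (A ∪ A') (B ∪ B')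
merge {R = R} {r = a , b , c} {A = A} {B} {A'} {B'} {p} {q} consistent (_ , a≢c , _)
      (A⊆L , B⊆L , (compA , compB , _) , side) (A'⊆L , B'⊆L , (compA' , compB' , _) , _)
      p∈A p∈A' q∈B q∈B' =
  ∪-lub A⊆L A'⊆L , ∪-lub B⊆L B'⊆L ,
  two-components (p⊆p∪q A' p∈A) (p⊆p∪q B' q∈B) reachP reachQ p↛q , merged-side side
  where
  open Ahograph R
  U : Subset _
  U = (A ∪ A') ∪ (B ∪ B')

  AB⊆U : A ∪ B ⊆ U
  AB⊆U = ∪-mono (p⊆p∪q A') (p⊆p∪q B')

  A'B'⊆U : A' ∪ B' ⊆ U
  A'B'⊆U = ∪-mono (q⊆p∪q A A') (q⊆p∪q B B')

  reachP : ∀ {y} → y ∈ A ∪ A' → Path U p y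
  reachP y∈ = [ (λ y∈A  → path-mono AB⊆U (component-path compA p∈A y∈A))
              , (λ y∈A' → path-mono A'B'⊆U (component-path compA' p∈A' y∈A')) ]
              (x∈p∪q⁻ A A' y∈)

  reachQ : ∀ {y} → y ∈ B ∪ B' → Path U q y
  reachQ y∈ = [ (λ y∈B  → path-mono AB⊆U (component-path compB q∈B y∈B))
              , (λ y∈B' → path-mono A'B'⊆U (component-path compB' q∈B' y∈B')) ]
              (x∈p∪q⁻ B B' y∈)

  a∈U×c∈U : (a ∈ A × b ∈ A × c ∈ B) ⊎ (a ∈ B × b ∈ B × c ∈ A) → a ∈ U × c ∈ U
  a∈U×c∈U (inj₁ (a∈A , _ , c∈B)) = AB⊆U (p⊆p∪q B a∈A) , AB⊆U (q⊆p∪q A B c∈B)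
  a∈U×c∈U (inj₂ (a∈B , _ , c∈A)) = AB⊆U (q⊆p∪q A B a∈B) , AB⊆U (p⊆p∪q B c∈A)

  p↛q : ¬ Path U p q
  p↛q p⇝q = aho consistent (∪-lub (∪-lub A⊆L A'⊆L) (∪-lub B⊆L B'⊆L))
                (proj₁ (a∈U×c∈U side)) (proj₂ (a∈U×c∈U side)) a≢c
                (λ x∈U y∈U → path-sym (reach x∈U) ◅◅ reach y∈U)
    where
    reach : ∀ {y} → y ∈ U → Path U p y
    reach y∈ = [ reachP , (λ y∈Q → p⇝q ◅◅ reachQ y∈Q) ] (x∈p∪q⁻ (A ∪ A') (B ∪ B') y∈)

  merged-side : (a ∈ A × b ∈ A × c ∈ B) ⊎ (a ∈ B × b ∈ B × c ∈ A) →
                (a ∈ A ∪ A' × b ∈ A ∪ A' × c ∈ B ∪ B') ⊎ (a ∈ B ∪ B' × b ∈ B ∪ B' × c ∈ A ∪ A')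
  merged-side (inj₁ (a∈ , b∈ , c∈)) = inj₁ (p⊆p∪q A' a∈ , p⊆p∪q A' b∈ , p⊆p∪q B' c∈)
  merged-side (inj₂ (a∈ , b∈ , c∈)) = inj₂ (p⊆p∪q B' a∈ , p⊆p∪q B' b∈ , p⊆p∪q A' c∈)

-- Hence 𝔏*(r;R) absorbs every pair of some 𝔏(r';R) overlapping it on both
-- sides: by maximality, A ∪ B ⊆ A ∪ A' ∪ B ∪ B' is an equality of sets.
absorb : ∀ {n} {R : TripleSet n} {r r' : Triple n} {A B A' B' p q} →
         Consistent R → ValidTriple r → IsLStar r R A B → InLSet r' R A' B' →
         p ∈ A → p ∈ A' → q ∈ B → q ∈ B' → A' ∪ B' ⊆ A ∪ B
absorb {A = A} {B} {A'} {B'} consistent valid (inL , maximal) inL' p∈A p∈A' q∈B q∈B' =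
  ⊆-trans (∪-mono (q⊆p∪q A A') (q⊆p∪q B B'))
          (⊇-by-card (∪-mono (p⊆p∪q A') (p⊆p∪q B'))
                     (maximal _ _ (merge consistent valid inL inL' p∈A p∈A' q∈B q∈B')))

mainTheorem15 : ∀ {n} (R : TripleSet n) → All ValidTriple R → Consistent R →
                ∀ A B A' B' → InLStarR R A B → InLStarR R A' B' →
                ¬ SamePair A B A' B' →
                Nonempty (A ∩ A') → Empty (B ∩ B')
mainTheorem15 R valid consistent A B A' B'
  (r , r∈R , lstar@((_ , _ , (compA , compB , _) , _) , _))
  (r' , r'∈R , lstar'@((_ , _ , (compA' , compB' , _) , _) , _))
  different (p , p∈A∩A') (q , q∈B∩B') =
  different (inj₁ (component-unique compA compA' AB⊆A'B' A'B'⊆AB p∈A p∈A' ,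
                   component-unique compB compB' AB⊆A'B' A'B'⊆AB q∈B q∈B'))
  where
  open Ahograph R
  p∈A : p ∈ A
  p∈A = proj₁ (x∈p∩q⁻ A A' p∈A∩A')

  p∈A' : p ∈ A'
  p∈A' = proj₂ (x∈p∩q⁻ A A' p∈A∩A')

  q∈B : q ∈ B
  q∈B = proj₁ (x∈p∩q⁻ B B' q∈B∩B')

  q∈B' : q ∈ B'
  q∈B' = proj₂ (x∈p∩q⁻ B B' q∈B∩B')

  A'B'⊆AB : A' ∪ B' ⊆ A ∪ B
  A'B'⊆AB = absorb consistent (All.lookup valid r∈R) lstar (proj₁ lstar') p∈A p∈A' q∈B q∈B'

  AB⊆A'B' : A ∪ B ⊆ A' ∪ B'
  AB⊆A'B' = absorb consistent (All.lookup valid r'∈R) lstar' (proj₁ lstar) p∈A' p∈A q∈B' q∈B
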